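{- Let $M$ be a clustering method that satisfies the Connectivity axiom. Then there exists an integer $n_0 \geq 1$ such that for every network $N$ and every cluster $c$ of $M(N)$ with $|c| \geq n_0$, the induced subgraph $N[c]$ has no cut edge.
   Context: A network is a finite simple undirected unweighted graph $N=(V,E)$ (no edge or vertex weights, no distance matrix). A clustering of $N$ is a partition of $V$ into nonempty sets called clusters. For $S\subseteq V$, $N[S]$ denotes the subgraph of $N$ induced by $S$. A clustering method $M$ assigns to every network $N$ a clustering $M(N)$. The minimum edge cut size of a graph $H$ is the minimum number of edges of $H$ whose removal leaves $H$ disconnected (it is $0$ if $H$ is already disconnected). A cut edge of $H$ is an edge whose removal increases the number of connected components of $H$. Connectivity axiom: $M$ satisfies Connectivity if there exists a function $f:\mathbb{R}^+\to\mathbb{R}^+$ that is non-negative, non-decreasing and satisfies $f(x)\to\infty$ as $x\to\infty$, such that for every network $N$ and every cluster $c$ of $M(N)$ with $|c|\geq 2$, the minimum edge cut size of $N[c]$ is strictly greater than $f(|c|)$. -}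

module Defs where

open import Data.Bool using (Bool; true; false; _∧_; _∨_; not; if_then_else_)
open import Data.Nat using (ℕ; zero; suc; _+_; _≤_; _<_; _<ᵇ_; _≡ᵇ_)
open import Data.Fin using (Fin; toℕ)
open import Data.List using (List; map; allFin)
open import Data.Nat.ListAction using (sum)
open import Data.Product using (Σ; ∃; _×_; _,_)
open import Relation.Binary.PropositionalEquality using (_≡_)
open import Relation.Nullary using (¬_)

record Network : Set where
  field
    size   : ℕ
    adj    : Fin size → Fin size → Bool
    adj-sym    : ∀ u v → adj u v ≡ adj v u
    adj-irrefl : ∀ u → adj u u ≡ false
open Network public

-- A clustering of N: each vertex gets a cluster label; the clusters are the
-- (automatically nonempty) fibres of the labelling.  Every partition arises this way.
Clustering : Network → Set
Clustering N = Fin (size N) → ℕ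

ClusteringMethod : Set
ClusteringMethod = (N : Network) → Clustering N

VSet : ℕ → Set
VSet n = Fin n → Bool

Graph : ℕ → Set
Graph n = Fin n → Fin n → Bool

card : ∀ {n} → VSet n → ℕ
card {n} S = sum (map (λ v → if S v then 1 else 0) (allFin n))

countEdges : ∀ {n} → Graph n → ℕ
countEdges {n} E =
  sum (map (λ u → sum (map (λ v → if (toℕ u <ᵇ toℕ v) ∧ E u v then 1 else 0) (allFin n))) (allFin n))

-- The cluster of M(N) containing vertex u (every cluster is of this form).
clusterOf : (N : Network) → Clustering N → Fin (size N) → VSet (size N)
clusterOf N cl u v = cl v ≡ᵇ cl u

-- The induced subgraph N[S]: vertex set S, edges of N with both ends in S.
-- We represent a graph H as a pair (vertex set S, edge relation E), with E ⊆ S × S.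
record SubGraph (n : ℕ) : Set where
  constructor ⟨_,_⟩
  field
    verts : VSet n
    edges : Graph n
open SubGraph public

induced : (N : Network) → VSet (size N) → SubGraph (size N)
induced N S = ⟨ S , (λ u v → adj N u v ∧ S u ∧ S v) ⟩

data Reach {n : ℕ} (H : SubGraph n) (u : Fin n) : Fin n → Set where
  here : verts H u ≡ true → Reach H u u
  step : ∀ {w v} → Reach H u w → edges H w v ≡ true → verts H v ≡ true → Reach H u v

Connected : ∀ {n} → SubGraph n → Set
Connected {n} H = ∀ (u v : Fin n) → verts H u ≡ true → verts H v ≡ true → Reach H u v

removeEdges : ∀ {n} → SubGraph n → Graph n → SubGraph n
removeEdges H R = ⟨ verts H , (λ u v → edges H u v ∧ not (R u v ∨ R v u)) ⟩

removedEdges : ∀ {n} → SubGraph n → Graph n → Graph n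
removedEdges H R u v = edges H u v ∧ (R u v ∨ R v u)

IsEdgeCut : ∀ {n} → SubGraph n → Graph n → ℕ → Set
IsEdgeCut H R k = countEdges (removedEdges H R) ≡ k × ¬ Connected (removeEdges H R)

-- The minimum edge cut size of H is k (0 if H is already disconnected).
IsMinEdgeCutSize : ∀ {n} → SubGraph n → ℕ → Set
IsMinEdgeCutSize {n} H k =
  (Σ (Graph n) λ R → IsEdgeCut H R k) × (∀ (R : Graph n) (j : ℕ) → IsEdgeCut H R j → k ≤ j)

NonDecreasing : (ℕ → ℕ) → Set
NonDecreasing f = ∀ x y → x ≤ y → f x ≤ f y

TendsToInfinity : (ℕ → ℕ) → Set
TendsToInfinity f = ∀ (b : ℕ) → ∃ λ x → ∀ y → x ≤ y → b ≤ f y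

SatisfiesConnectivity : ClusteringMethod → Set
SatisfiesConnectivity M =
  Σ (ℕ → ℕ) λ f → NonDecreasing f × TendsToInfinity f ×
    (∀ (N : Network) (u : Fin (size N)) →
      let c = clusterOf N (M N) u in
      2 ≤ card c → ∀ (k : ℕ) → IsMinEdgeCutSize (induced N c) k → f (card c) < k)

-- A cut edge of H: an edge {u,v} of H whose removal disconnects u from v
-- (equivalently, increases the number of connected components).
IsCutEdge : ∀ {n} → SubGraph n → Fin n → Fin n → Set
IsCutEdge {n} H u v =
  edges H u v ≡ true ×
  ¬ Reach (removeEdges H (λ x y → (toℕ x ≡ᵇ toℕ u) ∧ (toℕ y ≡ᵇ toℕ v))) u v

HasCutEdge : ∀ {n} → SubGraph n → Set
HasCutEdge {n} H = Σ (Fin n) λ u → Σ (Fin n) λ v → IsCutEdge H u v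

{-# OPTIONS --safe #-}
-- A cut edge of N[c] is an edge cut of size one, so the minimum edge cut size
-- of N[c] is 0 or 1, and Connectivity forces f(|c|) < 1.  Since f tends to
-- infinity, f(|c|) ≥ 1 once |c| is large, so large clusters have no cut edge.
module Submission where

open import Defs
open import Data.Bool using (true; false; _∧_; _∨_; if_then_else_)
open import Data.Bool.Properties using (T-≡; ∧-comm; ∨-comm)
open import Data.Empty using (⊥-elim)
open import Data.Fin using (Fin; toℕ; zero; suc)
open import Data.Fin.Properties using (suc-injective; toℕ-injective)
open import Data.List using (map; tabulate; allFin)
open import Data.List.Properties using (map-tabulate)
open import Data.Nat using (ℕ; _+_; _≤_; _<_; _≡ᵇ_; _<ᵇ_; z≤n; s≤s)
open import Data.Nat.Induction using (<-rec)
open import Data.Nat.ListAction using (sum)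
open import Data.Nat.Properties
  using (+-identityʳ; ≤-refl; ≤-trans; <⇒≤; ≮⇒≥; ≤⇒≯; <-≤-trans; <-asym; <-cmp;
         ≡ᵇ⇒≡; ≡⇒≡ᵇ; <ᵇ⇒<; <⇒<ᵇ; m+n≤o⇒m≤o; m+n≤o⇒n≤o)
open import Data.Product using (Σ; ∃; _×_; _,_; proj₁; proj₂) renaming (swap to ×-swap)
open import Data.Sum using (_⊎_; inj₁; inj₂) renaming (swap to ⊎-swap)
open import Function using (_∘_; case_of_)
open import Function.Bundles using (Equivalence)
open import Relation.Binary.Definitions using (tri<; tri≈; tri>)
open import Relation.Binary.PropositionalEquality
  using (_≡_; _≢_; refl; sym; trans; cong; cong₂; module ≡-Reasoning)
open import Relation.Nullary using (¬_)

open Equivalence using (from; to)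

∧-true⁻ : ∀ {x y} → x ∧ y ≡ true → x ≡ true × y ≡ true
∧-true⁻ {true} y≡true = refl , y≡true

∨-true⁻ : ∀ {x y} → x ∨ y ≡ true → x ≡ true ⊎ y ≡ true
∨-true⁻ {true}  _      = inj₁ refl
∨-true⁻ {false} y≡true = inj₂ y≡true

sum-tabulate-0 : ∀ {n} (h : Fin n → ℕ) → (∀ a → h a ≡ 0) → sum (tabulate h) ≡ 0
sum-tabulate-0 {ℕ.zero}  h h≡0 = refl
sum-tabulate-0 {ℕ.suc n} h h≡0 = cong₂ _+_ (h≡0 zero) (sum-tabulate-0 (h ∘ suc) (h≡0 ∘ suc))

sum-tabulate-single : ∀ {n} (h : Fin n → ℕ) (a₀ : Fin n) →
  (∀ a → a ≢ a₀ → h a ≡ 0) → sum (tabulate h) ≡ h a₀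
sum-tabulate-single h zero h≡0 =
  trans (cong (h zero +_) (sum-tabulate-0 (h ∘ suc) (λ a → h≡0 (suc a) λ ())))
        (+-identityʳ (h zero))
sum-tabulate-single h (suc a₀) h≡0 =
  cong₂ _+_ (h≡0 zero λ ())
            (sum-tabulate-single (h ∘ suc) a₀ λ a a≢a₀ → h≡0 (suc a) (a≢a₀ ∘ suc-injective))

sum-allFin : ∀ {n} (h : Fin n → ℕ) → sum (map h (allFin n)) ≡ sum (tabulate h)
sum-allFin h = cong sum (map-tabulate (λ a → a) h)

OnlyJoins : ∀ {n} → Graph n → Fin n → Fin n → Set
OnlyJoins E p q = ∀ {a b} → E a b ≡ true → (a ≡ p × b ≡ q) ⊎ (a ≡ q × b ≡ p)

countEdges-ordered : ∀ {n} (E : Graph n) {p q : Fin n} →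
  toℕ p < toℕ q → E p q ≡ true → OnlyJoins E p q → countEdges E ≡ 1
countEdges-ordered {n} E {p} {q} p<q pq∈E only = begin
  countEdges E                  ≡⟨ sum-allFin row ⟩
  sum (tabulate row)            ≡⟨ sum-tabulate-single row p row-0 ⟩
  row p                         ≡⟨ sum-allFin (entry p) ⟩
  sum (tabulate (entry p))      ≡⟨ sum-tabulate-single (entry p) q (λ b b≢q → entry-0 (b≢q ∘ proj₂)) ⟩
  entry p q                     ≡⟨ entry-pq ⟩
  1                             ∎
  where
  open ≡-Reasoning
  entry : Fin n → Fin n → ℕ
  entry a b = if (toℕ a <ᵇ toℕ b) ∧ E a b then 1 else 0
  row : Fin n → ℕ
  row a = sum (map (entry a) (allFin n))
  entry-0 : ∀ {a b} → ¬ (a ≡ p × b ≡ q) → entry a b ≡ 0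
  entry-0 {a} {b} ≢pq with (toℕ a <ᵇ toℕ b) ∧ E a b in eq
  ... | false = refl
  ... | true with ∧-true⁻ eq
  ... | a<b , ab∈E with only ab∈E
  ... | inj₁ ≡pq = ⊥-elim (≢pq ≡pq)
  ... | inj₂ (refl , refl) = ⊥-elim (<-asym p<q (<ᵇ⇒< _ _ (from T-≡ a<b)))
  row-0 : ∀ a → a ≢ p → row a ≡ 0
  row-0 a a≢p = trans (sum-allFin (entry a)) (sum-tabulate-0 (entry a) λ b → entry-0 (a≢p ∘ proj₁))
  entry-pq : entry p q ≡ 1
  entry-pq rewrite to T-≡ (<⇒<ᵇ p<q) | pq∈E = refl

countEdges-pair : ∀ {n} (E : Graph n) {p q : Fin n} → p ≢ q →
  E p q ≡ true → E q p ≡ true → OnlyJoins E p q → countEdges E ≡ 1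
countEdges-pair E {p} {q} p≢q pq∈E qp∈E only with <-cmp (toℕ p) (toℕ q)
... | tri< p<q _ _ = countEdges-ordered E p<q pq∈E only
... | tri≈ _ p≡q _ = ⊥-elim (p≢q (toℕ-injective p≡q))
... | tri> _ _ q<p = countEdges-ordered E q<p qp∈E (⊎-swap ∘ only)

edgeAt : ∀ {n} → Fin n → Fin n → Graph n
edgeAt u v x y = (toℕ x ≡ᵇ toℕ u) ∧ (toℕ y ≡ᵇ toℕ v)

edgeAt-refl : ∀ {n} (u v : Fin n) → edgeAt u v u v ≡ true
edgeAt-refl u v rewrite to T-≡ (≡⇒≡ᵇ (toℕ u) (toℕ u) refl)
                      | to T-≡ (≡⇒≡ᵇ (toℕ v) (toℕ v) refl) = refl

edgeAt⁻ : ∀ {n} {u v x y : Fin n} → edgeAt u v x y ≡ true → x ≡ u × y ≡ v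
edgeAt⁻ xy∈R with ∧-true⁻ xy∈R
... | x≡u , y≡v = toℕ-injective (≡ᵇ⇒≡ _ _ (from T-≡ x≡u)) , toℕ-injective (≡ᵇ⇒≡ _ _ (from T-≡ y≡v))

removedEdges-edgeAt : ∀ {n} (H : SubGraph n) {u v : Fin n} →
  OnlyJoins (removedEdges H (edgeAt u v)) u v
removedEdges-edgeAt H ab∈E with ∨-true⁻ (proj₂ (∧-true⁻ ab∈E))
... | inj₁ ab∈R = inj₁ (edgeAt⁻ ab∈R)
... | inj₂ ba∈R = inj₂ (×-swap (edgeAt⁻ ba∈R))

removedEdges-sym : ∀ {n} (H : SubGraph n) (R : Graph n) →
  (∀ a b → edges H a b ≡ edges H b a) →
  ∀ a b → removedEdges H R a b ≡ removedEdges H R b a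
removedEdges-sym H R sym-H a b = cong₂ _∧_ (sym-H a b) (∨-comm (R a b) (R b a))

induced-sym : ∀ (N : Network) S a b → edges (induced N S) a b ≡ edges (induced N S) b a
induced-sym N S a b = cong₂ _∧_ (adj-sym N a b) (∧-comm (S a) (S b))

induced-edge⇒≢ : ∀ (N : Network) S {u v : Fin (size N)} → edges (induced N S) u v ≡ true → u ≢ v
induced-edge⇒≢ N S {u} uv∈H refl =
  case trans (sym (adj-irrefl N u)) (proj₁ (∧-true⁻ uv∈H)) of λ ()

induced-edge⇒verts : ∀ (N : Network) S {u v : Fin (size N)} → edges (induced N S) u v ≡ true →
  S u ≡ true × S v ≡ true
induced-edge⇒verts N S {u} {v} uv∈H = ∧-true⁻ (proj₂ (∧-true⁻ {adj N u v} uv∈H))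

cutEdge⇒edgeCut : ∀ (N : Network) S {u v} → IsCutEdge (induced N S) u v →
  IsEdgeCut (induced N S) (edgeAt u v) 1
cutEdge⇒edgeCut N S {u} {v} (uv∈H , u↛v) = count , disconnected
  where
  H = induced N S
  uv-removed : removedEdges H (edgeAt u v) u v ≡ true
  uv-removed rewrite uv∈H | edgeAt-refl u v = refl
  count : countEdges (removedEdges H (edgeAt u v)) ≡ 1
  count = countEdges-pair _ (induced-edge⇒≢ N S uv∈H) uv-removed
    (trans (removedEdges-sym H (edgeAt u v) (induced-sym N S) v u) uv-removed)
    (removedEdges-edgeAt H)
  disconnected : ¬ Connected (removeEdges H (edgeAt u v))
  disconnected connected with induced-edge⇒verts N S uv∈H
  ... | u∈S , v∈S = u↛v (connected u v u∈S v∈S)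

minEdgeCut-exists : ∀ {n} (H : SubGraph n) {R : Graph n} {k : ℕ} → IsEdgeCut H R k →
  ¬ ¬ (∃ λ j → j ≤ k × IsMinEdgeCutSize H j)
minEdgeCut-exists {n} H {R} {k} = <-rec Goal exists k R
  where
  Goal : ℕ → Set
  Goal k = ∀ (R : Graph n) → IsEdgeCut H R k → ¬ ¬ (∃ λ j → j ≤ k × IsMinEdgeCutSize H j)
  exists : ∀ k → (∀ {j} → j < k → Goal j) → Goal k
  exists k smaller R cut noMin = noMin (k , ≤-refl , (R , cut) , minimal)
    where
    minimal : ∀ (R′ : Graph n) j → IsEdgeCut H R′ j → k ≤ j
    minimal R′ j cut′ = ≮⇒≥ λ j<k → smaller j<k R′ cut′ λ (i , i≤j , min) →
      noMin (i , ≤-trans i≤j (<⇒≤ j<k) , min)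

lemma1 : (M : ClusteringMethod) → SatisfiesConnectivity M →
    Σ ℕ λ n₀ → 1 ≤ n₀ ×
      (∀ (N : Network) (u : Fin (size N)) →
        n₀ ≤ card (clusterOf N (M N) u) →
        ¬ HasCutEdge (induced N (clusterOf N (M N) u)))
lemma1 M (f , _ , f→∞ , connectivity) with f→∞ 1
... | x , f≥1 = 2 + x , s≤s z≤n , noCutEdge
  where
  noCutEdge : ∀ (N : Network) (u : Fin (size N)) →
    2 + x ≤ card (clusterOf N (M N) u) → ¬ HasCutEdge (induced N (clusterOf N (M N) u))
  noCutEdge N u large (v , w , cutEdge) =
    minEdgeCut-exists (induced N c) {edgeAt v w} (cutEdge⇒edgeCut N c cutEdge) λ (j , j≤1 , minCut) →
      ≤⇒≯ (f≥1 (card c) (m+n≤o⇒n≤o 2 large))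
          (<-≤-trans (connectivity N u (m+n≤o⇒m≤o 2 large) j minCut) j≤1)
    where
    c = clusterOf N (M N) u
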